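{- Let $G$ be a finite group, let $\Omega={\mathbb Z}_2\times G$, and let $X,Y$ be Haar objects of $G$ in some class ${\mathcal K}$ of combinatorial objects. Then $X$ and $Y$ are isomorphic by an element of $N_{S_\Omega}(\widehat G_L)$ (i.e. $\phi(X)=Y$ for some $\phi\in N_{S_\Omega}(\widehat G_L)$) if and only if they are isomorphic by an element of $N_{S_\Omega}(\widehat G_L)$ of the form $\tau^i\widehat\alpha\bar g$ with $i\in{\mathbb Z}_2$, $\alpha\in{\rm Aut}(G)$, $g\in G$.
   Context: Permutations compose right to left. For $g\in G$, $\widehat g_L(i,x)=(i,gx)$ and $\widehat G_L=\{\widehat g_L:g\in G\}\le S_\Omega$. Further $\tau(i,x)=(i+1,x)$; for $\alpha\in{\rm Aut}(G)$, $\widehat\alpha(i,x)=(i,\alpha(x))$; for $g\in G$, $\bar g(0,x)=(0,x)$, $\bar g(1,x)=(1,xg^{ -1})$. A class ${\mathcal K}$ of combinatorial objects on the point set $\Omega$ is a collection of structures on $\Omega$ (e.g. graphs with vertex set $\Omega$) on which $S_\Omega$ acts, closed under this action; for $X\in{\mathcal K}$, ${\rm Aut}(X)=\{\phi\in S_\Omega:\phi(X)=X\}$. $X$ is a Haar object of $G$ if $\widehat G_L\le{\rm Aut}(X)$. -}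

module Defs where

open import Level using (0ℓ)
open import Data.Fin using (Fin; zero; suc)
open import Data.Product using (Σ; _×_; _,_; proj₁; proj₂; ∃)
open import Function.Bundles using (_↔_)
open import Relation.Binary.PropositionalEquality
open import Relation.Binary.Bundles using (Setoid)
open import Algebra.Structures using (IsGroup)
open import Data.Nat using (ℕ)

record Perm (A : Set) : Set where
  field
    to      : A → A
    from    : A → A
    to∘from : ∀ x → to (from x) ≡ x
    from∘to : ∀ x → from (to x) ≡ x
open Perm public

idₚ : ∀ {A} → Perm A
idₚ = record { to = λ x → x ; from = λ x → x ; to∘from = λ _ → refl ; from∘to = λ _ → refl }

_∘ₚ_ : ∀ {A} → Perm A → Perm A → Perm A
φ ∘ₚ ψ = record
  { to = λ x → to φ (to ψ x)
  ; from = λ x → from ψ (from φ x)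
  ; to∘from = λ x → trans (cong (to φ) (to∘from ψ (from φ x))) (to∘from φ x)
  ; from∘to = λ x → trans (cong (from ψ) (from∘to φ (to ψ x))) (from∘to ψ x)
  }

_⁻¹ₚ : ∀ {A} → Perm A → Perm A
φ ⁻¹ₚ = record { to = from φ ; from = to φ ; to∘from = from∘to φ ; from∘to = to∘from φ }

_≗ₚ_ : ∀ {A} → Perm A → Perm A → Set
φ ≗ₚ ψ = ∀ x → to φ x ≡ to ψ x

record FinGroup : Set₁ where
  field
    Carrier : Set
    _∙_     : Carrier → Carrier → Carrier
    ε       : Carrier
    _⁻¹     : Carrier → Carrier
    isGroup : IsGroup _≡_ _∙_ ε _⁻¹
    finite  : Σ ℕ λ n → Carrier ↔ Fin n
  infixl 7 _∙_
  infix 8 _⁻¹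
  open IsGroup isGroup public using (assoc; identityˡ; identityʳ; inverseˡ; inverseʳ)

record Aut (G : FinGroup) : Set where
  open FinGroup G
  field
    perm : Perm Carrier
    hom  : ∀ x y → to perm (x ∙ y) ≡ to perm x ∙ to perm y

Ω : FinGroup → Set
Ω G = Fin 2 × FinGroup.Carrier G

module _ (G : FinGroup) where
  open FinGroup G
  open ≡-Reasoning

  private
    cancelˡ : ∀ a x → a ⁻¹ ∙ (a ∙ x) ≡ x
    cancelˡ a x = begin
      a ⁻¹ ∙ (a ∙ x) ≡⟨ sym (assoc _ _ _) ⟩
      (a ⁻¹ ∙ a) ∙ x ≡⟨ cong (_∙ x) (inverseˡ a) ⟩
      ε ∙ x          ≡⟨ identityˡ x ⟩
      x ∎
    cancelˡ' : ∀ a x → a ∙ (a ⁻¹ ∙ x) ≡ x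
    cancelˡ' a x = begin
      a ∙ (a ⁻¹ ∙ x) ≡⟨ sym (assoc _ _ _) ⟩
      (a ∙ a ⁻¹) ∙ x ≡⟨ cong (_∙ x) (inverseʳ a) ⟩
      ε ∙ x          ≡⟨ identityˡ x ⟩
      x ∎
    cancelʳ : ∀ a x → (x ∙ a ⁻¹) ∙ a ≡ x
    cancelʳ a x = begin
      (x ∙ a ⁻¹) ∙ a ≡⟨ assoc _ _ _ ⟩
      x ∙ (a ⁻¹ ∙ a) ≡⟨ cong (x ∙_) (inverseˡ a) ⟩
      x ∙ ε          ≡⟨ identityʳ x ⟩
      x ∎
    cancelʳ' : ∀ a x → (x ∙ a) ∙ a ⁻¹ ≡ x
    cancelʳ' a x = begin
      (x ∙ a) ∙ a ⁻¹ ≡⟨ assoc _ _ _ ⟩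
      x ∙ (a ∙ a ⁻¹) ≡⟨ cong (x ∙_) (inverseʳ a) ⟩
      x ∙ ε          ≡⟨ identityʳ x ⟩
      x ∎

  hatL : Carrier → Perm (Ω G)
  hatL g = record
    { to = λ { (i , x) → (i , g ∙ x) }
    ; from = λ { (i , x) → (i , g ⁻¹ ∙ x) }
    ; to∘from = λ { (i , x) → cong (i ,_) (cancelˡ' g x) }
    ; from∘to = λ { (i , x) → cong (i ,_) (cancelˡ g x) }
    }

  flip2 : Fin 2 → Fin 2
  flip2 zero = suc zero
  flip2 (suc zero) = zero

  flip2-inv : ∀ i → flip2 (flip2 i) ≡ i
  flip2-inv zero = refl
  flip2-inv (suc zero) = refl

  τ : Perm (Ω G)
  τ = record
    { to = λ { (i , x) → (flip2 i , x) }
    ; from = λ { (i , x) → (flip2 i , x) }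
    ; to∘from = λ { (i , x) → cong (_, x) (flip2-inv i) }
    ; from∘to = λ { (i , x) → cong (_, x) (flip2-inv i) }
    }

  τ^ : Fin 2 → Perm (Ω G)
  τ^ zero = idₚ
  τ^ (suc zero) = τ

  hatAut : Aut G → Perm (Ω G)
  hatAut α = record
    { to = λ { (i , x) → (i , to p x) }
    ; from = λ { (i , x) → (i , from p x) }
    ; to∘from = λ { (i , x) → cong (i ,_) (to∘from p x) }
    ; from∘to = λ { (i , x) → cong (i ,_) (from∘to p x) }
    }
    where p = Aut.perm α

  bar : Carrier → Perm (Ω G)
  bar g = record { to = t ; from = f ; to∘from = tf ; from∘to = ft }
    where
    t f : Ω G → Ω G
    t (zero , x) = (zero , x)
    t (suc zero , x) = (suc zero , x ∙ g ⁻¹)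
    f (zero , x) = (zero , x)
    f (suc zero , x) = (suc zero , x ∙ g)
    tf : ∀ y → t (f y) ≡ y
    tf (zero , x) = refl
    tf (suc zero , x) = cong (suc zero ,_) (cancelʳ' g x)
    ft : ∀ y → f (t y) ≡ y
    ft (zero , x) = refl
    ft (suc zero , x) = cong (suc zero ,_) (cancelʳ g x)

  -- φ ∈ N_{S_Ω}(Ĝ_L) :  φ Ĝ_L φ⁻¹ = Ĝ_L (as sets of permutations)
  InNormalizer : Perm (Ω G) → Set
  InNormalizer φ =
    (∀ g → ∃ λ h → (φ ∘ₚ (hatL g ∘ₚ (φ ⁻¹ₚ))) ≗ₚ hatL h) ×
    (∀ h → ∃ λ g → (φ ∘ₚ (hatL g ∘ₚ (φ ⁻¹ₚ))) ≗ₚ hatL h)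

-- A class of combinatorial objects on Ω: a collection of structures
-- (a setoid of objects) on which S_Ω acts.

record PermClass (A : Set) : Set₁ where
  field
    Obj      : Setoid 0ℓ 0ℓ
  open Setoid Obj public renaming (Carrier to Object)
  field
    act      : Perm A → Object → Object
    act-cong : ∀ {φ ψ X Y} → φ ≗ₚ ψ → X ≈ Y → act φ X ≈ act ψ Y
    act-id   : ∀ X → act idₚ X ≈ X
    act-∘    : ∀ φ ψ X → act (φ ∘ₚ ψ) X ≈ act φ (act ψ X)

module _ (G : FinGroup) (K : PermClass (Ω G)) where
  open PermClass K

  IsHaar : Object → Set
  IsHaar X = ∀ g → act (hatL G g) X ≈ X

{-# OPTIONS --safe #-}
module Submission where

-- If φ normalises Ĝ_L then φ ĝ_L = f(g)^_L φ for some map f, so φ(j , x) is the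
-- left translate of φ(j , 1) by f(x): the ℤ₂-coordinate of φ(j , x) depends on j
-- only, and φ permutes the two levels. Composing φ with a left translation (which
-- fixes every Haar object) and a power of τ yields ψ fixing (0 , 1) and both levels.
-- Then α(x) := second coordinate of ψ(0 , x) is an automorphism of G, and
-- ψ(1 , x) = (1 , α(x) c) for a constant c, so ψ = α̂ ḡ with g = (α⁻¹ c)⁻¹.

open import Defs
open import Algebra.Bundles using (Group)
open import Data.Empty using (⊥-elim)
open import Data.Fin using (Fin; zero; suc)
open import Data.Product using (Σ; ∃; _×_; _,_; proj₁; proj₂)
open import Function using (id; _∘_)
open import Function.Bundles using (_⇔_; mk⇔)
open import Relation.Binary.PropositionalEquality

module _ (G : FinGroup) where
  open FinGroup G
  open ≡-Reasoning

  private
    group : Group _ _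
    group = record { isGroup = isGroup }

  open import Algebra.Properties.Group group using (⁻¹-involutive; \\-leftDividesʳ)

  flip2-fixedPointFree : ∀ i → flip2 G i ≢ i
  flip2-fixedPointFree zero ()
  flip2-fixedPointFree (suc zero) ()

  τ^-self : ∀ i x → to (τ^ G i) (i , x) ≡ (zero , x)
  τ^-self zero x = refl
  τ^-self (suc zero) x = refl

  τ^-flip2 : ∀ i x → to (τ^ G i) (flip2 G i , x) ≡ (suc zero , x)
  τ^-flip2 zero x = refl
  τ^-flip2 (suc zero) x = refl

  τ^-involutive : ∀ i z → to (τ^ G i) (to (τ^ G i) z) ≡ z
  τ^-involutive zero z = refl
  τ^-involutive (suc zero) (j , x) = cong (_, x) (flip2-inv G j)

  record Intertwines (φ : Perm (Ω G)) (f : Carrier → Carrier) : Set where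
    field commute : ∀ g z → to φ (to (hatL G g) z) ≡ to (hatL G (f g)) (to φ z)
  open Intertwines

  intertwines-∘ : ∀ {φ ψ f f′} → Intertwines φ f → Intertwines ψ f′ →
                  Intertwines (φ ∘ₚ ψ) (f ∘ f′)
  commute (intertwines-∘ {φ} {ψ} {f′ = f′} φ-f ψ-f′) g z =
    trans (cong (to φ) (commute ψ-f′ g z)) (commute φ-f (f′ g) (to ψ z))

  τ^-intertwines : ∀ i → Intertwines (τ^ G i) id
  commute (τ^-intertwines zero) g z = refl
  commute (τ^-intertwines (suc zero)) g (j , x) = refl

  hatAut-intertwines : ∀ α → Intertwines (hatAut G α) (to (Aut.perm α))
  commute (hatAut-intertwines α) g (j , x) = cong (j ,_) (Aut.hom α g x)

  bar-intertwines : ∀ c → Intertwines (bar G c) id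
  commute (bar-intertwines c) g (zero , x) = refl
  commute (bar-intertwines c) g (suc zero , x) = cong (suc zero ,_) (assoc g x (c ⁻¹))

  hatL-intertwines : ∀ c → Intertwines (hatL G c) (λ g → c ∙ g ∙ c ⁻¹)
  commute (hatL-intertwines c) g (j , x) = cong (j ,_) (begin
    c ∙ (g ∙ x)                ≡⟨ assoc c g x ⟨
    c ∙ g ∙ x                  ≡⟨ cong (c ∙ g ∙_) (\\-leftDividesʳ c x) ⟨
    c ∙ g ∙ (c ⁻¹ ∙ (c ∙ x))   ≡⟨ assoc (c ∙ g) (c ⁻¹) (c ∙ x) ⟨
    c ∙ g ∙ c ⁻¹ ∙ (c ∙ x)     ∎)

  inNormalizer⇒intertwines : ∀ {φ} (N : InNormalizer G φ) →
                             Intertwines φ (λ g → proj₁ (proj₁ N g))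
  commute (inNormalizer⇒intertwines {φ} (conj , _)) g z = begin
    to φ (to (hatL G g) z)                   ≡⟨ cong (to φ ∘ to (hatL G g)) (from∘to φ z) ⟨
    to φ (to (hatL G g) (from φ (to φ z)))   ≡⟨ proj₂ (conj g) (to φ z) ⟩
    to (hatL G (proj₁ (conj g))) (to φ z)    ∎

  intertwines⇒inNormalizer : ∀ {φ f} → Intertwines φ f → (∀ h → ∃ λ g → f g ≡ h) →
                             InNormalizer G φ
  intertwines⇒inNormalizer {φ} {f} φ-f f-surjective =
    (λ g → f g , conj g) ,
    λ h → let (g , fg≡h) = f-surjective h in
          g , λ z → trans (conj g z) (cong (λ k → to (hatL G k) z) fg≡h)
    where
    conj : ∀ g → (φ ∘ₚ (hatL G g ∘ₚ (φ ⁻¹ₚ))) ≗ₚ hatL G (f g)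
    conj g z = trans (commute φ-f g (from φ z)) (cong (to (hatL G (f g))) (to∘from φ z))

  standard-inNormalizer : ∀ i α g → InNormalizer G (τ^ G i ∘ₚ (hatAut G α ∘ₚ bar G g))
  standard-inNormalizer i α g =
    intertwines⇒inNormalizer
      (intertwines-∘ (τ^-intertwines i) (intertwines-∘ (hatAut-intertwines α) (bar-intertwines g)))
      (λ h → from (Aut.perm α) h , to∘from (Aut.perm α) h)

  intertwines-translate : ∀ {φ f} → Intertwines φ f →
                          ∀ j x → to φ (j , x) ≡ to (hatL G (f x)) (to φ (j , ε))
  intertwines-translate {φ} φ-f j x =
    trans (cong (λ y → to φ (j , y)) (sym (identityʳ x))) (commute φ-f x (j , ε))

  intertwines-level : ∀ {φ f} → Intertwines φ f →
                      ∀ j x → proj₁ (to φ (j , x)) ≡ proj₁ (to φ (j , ε))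
  intertwines-level φ-f j x = cong proj₁ (intertwines-translate φ-f j x)

  intertwines-swaps-levels : ∀ {φ f} → Intertwines φ f →
    proj₁ (to φ (suc zero , ε)) ≡ flip2 G (proj₁ (to φ (zero , ε)))
  -- With i the level of φ (0 , ε): some point is sent to level flip2 i, and it cannot lie
  -- on level 0, all of which goes to level i.
  intertwines-swaps-levels {φ} φ-f
    with from φ (flip2 G (proj₁ (to φ (zero , ε))) , ε)
       | to∘from φ (flip2 G (proj₁ (to φ (zero , ε))) , ε)
  ... | zero , x | φ⁻¹-hits =
    ⊥-elim (flip2-fixedPointFree _
      (trans (sym (cong proj₁ φ⁻¹-hits)) (intertwines-level φ-f zero x)))
  ... | suc zero , x | φ⁻¹-hits =
    trans (sym (intertwines-level φ-f (suc zero) x)) (cong proj₁ φ⁻¹-hits)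

  module LevelPreserving
    {ψ : Perm (Ω G)} {f : Carrier → Carrier} (ψ-f : Intertwines ψ f)
    (fixes-origin : to ψ (zero , ε) ≡ (zero , ε))
    (fixes-level₁ : proj₁ (to ψ (suc zero , ε)) ≡ suc zero)
    where

    preserves-level : ∀ j x → proj₁ (to ψ (j , x)) ≡ j
    preserves-level zero x = trans (intertwines-level ψ-f zero x) (cong proj₁ fixes-origin)
    preserves-level (suc zero) x = trans (intertwines-level ψ-f (suc zero) x) fixes-level₁

    inverse-preserves-level : ∀ j y → proj₁ (from ψ (j , y)) ≡ j
    inverse-preserves-level j y =
      trans (sym (preserves-level _ _)) (cong proj₁ (to∘from ψ (j , y)))

    on-level : ∀ j x → to ψ (j , x) ≡ (j , proj₂ (to ψ (j , x)))
    on-level j x = cong (_, proj₂ (to ψ (j , x))) (preserves-level j x)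

    α₀ : Carrier → Carrier
    α₀ x = proj₂ (to ψ (zero , x))

    α₀⁻¹ : Carrier → Carrier
    α₀⁻¹ y = proj₂ (from ψ (zero , y))

    α₀≡f : ∀ x → α₀ x ≡ f x
    α₀≡f x = begin
      α₀ x                                ≡⟨ cong proj₂ (intertwines-translate ψ-f zero x) ⟩
      f x ∙ proj₂ (to ψ (zero , ε))       ≡⟨ cong ((f x ∙_) ∘ proj₂) fixes-origin ⟩
      f x ∙ ε                             ≡⟨ identityʳ (f x) ⟩
      f x                                 ∎

    α₀-hom : ∀ x y → α₀ (x ∙ y) ≡ α₀ x ∙ α₀ y
    α₀-hom x y = begin
      α₀ (x ∙ y)   ≡⟨ cong proj₂ (commute ψ-f x (zero , y)) ⟩
      f x ∙ α₀ y   ≡⟨ cong (_∙ α₀ y) (α₀≡f x) ⟨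
      α₀ x ∙ α₀ y  ∎

    α₀-inverseˡ : ∀ y → α₀ (α₀⁻¹ y) ≡ y
    α₀-inverseˡ y = begin
      proj₂ (to ψ (zero , proj₂ w))
        ≡⟨ cong (λ j → proj₂ (to ψ (j , proj₂ w))) (inverse-preserves-level zero y) ⟨
      proj₂ (to ψ w)
        ≡⟨ cong proj₂ (to∘from ψ (zero , y)) ⟩
      y ∎
      where w = from ψ (zero , y)

    α₀-inverseʳ : ∀ x → α₀⁻¹ (α₀ x) ≡ x
    α₀-inverseʳ x = begin
      proj₂ (from ψ (zero , α₀ x))       ≡⟨ cong (proj₂ ∘ from ψ) (on-level zero x) ⟨
      proj₂ (from ψ (to ψ (zero , x)))   ≡⟨ cong proj₂ (from∘to ψ (zero , x)) ⟩
      x                                  ∎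

    α : Aut G
    α = record
      { perm = record { to = α₀ ; from = α₀⁻¹ ; to∘from = α₀-inverseˡ ; from∘to = α₀-inverseʳ }
      ; hom  = α₀-hom
      }

    c₁ : Carrier
    c₁ = proj₂ (to ψ (suc zero , ε))

    g : Carrier
    g = α₀⁻¹ c₁ ⁻¹

    level₁-coordinate : ∀ x → proj₂ (to ψ (suc zero , x)) ≡ α₀ (x ∙ g ⁻¹)
    level₁-coordinate x = begin
      proj₂ (to ψ (suc zero , x))  ≡⟨ cong proj₂ (intertwines-translate ψ-f (suc zero) x) ⟩
      f x ∙ c₁                     ≡⟨ cong (_∙ c₁) (α₀≡f x) ⟨
      α₀ x ∙ c₁                    ≡⟨ cong (α₀ x ∙_) (α₀-inverseˡ c₁) ⟨
      α₀ x ∙ α₀ (α₀⁻¹ c₁)          ≡⟨ cong (λ y → α₀ x ∙ α₀ y) (⁻¹-involutive (α₀⁻¹ c₁)) ⟨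
      α₀ x ∙ α₀ (g ⁻¹)             ≡⟨ α₀-hom x (g ⁻¹) ⟨
      α₀ (x ∙ g ⁻¹)                ∎

    standard-form : ψ ≗ₚ (hatAut G α ∘ₚ bar G g)
    standard-form (zero , x) = on-level zero x
    standard-form (suc zero , x) =
      trans (on-level (suc zero) x) (cong (suc zero ,_) (level₁-coordinate x))

  intertwines⇒standard-form : ∀ {φ f} → Intertwines φ f →
    Σ (Fin 2) λ i → Σ (Aut G) λ α → Σ Carrier λ g → Σ Carrier λ c →
      (τ^ G i ∘ₚ (hatAut G α ∘ₚ bar G g)) ≗ₚ (hatL G c ∘ₚ φ)
  intertwines⇒standard-form {φ} φ-f = i , L.α , L.g , c ⁻¹ , shape
    where
    i : Fin 2
    i = proj₁ (to φ (zero , ε))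
    c : Carrier
    c = proj₂ (to φ (zero , ε))
    ψ : Perm (Ω G)
    ψ = τ^ G i ∘ₚ (hatL G (c ⁻¹) ∘ₚ φ)

    fixes-origin : to ψ (zero , ε) ≡ (zero , ε)
    fixes-origin = trans (cong (to (τ^ G i) ∘ (i ,_)) (inverseˡ c)) (τ^-self i ε)

    fixes-level₁ : proj₁ (to ψ (suc zero , ε)) ≡ suc zero
    fixes-level₁ = begin
      proj₁ (to (τ^ G i) (proj₁ (to φ (suc zero , ε)) , y))
        ≡⟨ cong (λ j → proj₁ (to (τ^ G i) (j , y))) (intertwines-swaps-levels φ-f) ⟩
      proj₁ (to (τ^ G i) (flip2 G i , y))
        ≡⟨ cong proj₁ (τ^-flip2 i y) ⟩
      suc zero ∎
      where y = c ⁻¹ ∙ proj₂ (to φ (suc zero , ε))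

    module L = LevelPreserving
      (intertwines-∘ (τ^-intertwines i) (intertwines-∘ (hatL-intertwines (c ⁻¹)) φ-f))
      fixes-origin fixes-level₁

    shape : (τ^ G i ∘ₚ (hatAut G L.α ∘ₚ bar G L.g)) ≗ₚ (hatL G (c ⁻¹) ∘ₚ φ)
    shape z = trans (cong (to (τ^ G i)) (sym (L.standard-form z)))
                    (τ^-involutive i (to (hatL G (c ⁻¹)) (to φ z)))

module _ (G : FinGroup) (K : PermClass (Ω G)) where
  open PermClass K using (Obj; _≈_; act; act-cong; act-∘) renaming (refl to ≈-refl)

  normalizer-iso⇒standard-iso : ∀ {φ X Y} → IsHaar G K Y → InNormalizer G φ → act φ X ≈ Y →
    Σ (Fin 2) λ i → Σ (Aut G) λ α → Σ (FinGroup.Carrier G) λ g →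
      act (τ^ G i ∘ₚ (hatAut G α ∘ₚ bar G g)) X ≈ Y
  normalizer-iso⇒standard-iso {φ} {X} {Y} Y-haar φ-normalizes φX≈Y
    with intertwines⇒standard-form G (inNormalizer⇒intertwines G {φ} φ-normalizes)
  ... | i , α , g , c , χ≗cφ = i , α , g , (begin
      act (τ^ G i ∘ₚ (hatAut G α ∘ₚ bar G g)) X  ≈⟨ act-cong χ≗cφ ≈-refl ⟩
      act (hatL G c ∘ₚ φ) X                     ≈⟨ act-∘ (hatL G c) φ X ⟩
      act (hatL G c) (act φ X)                  ≈⟨ act-cong (λ _ → refl) φX≈Y ⟩
      act (hatL G c) Y                          ≈⟨ Y-haar c ⟩
      Y                                         ∎)
    where open import Relation.Binary.Reasoning.Setoid Obj

mainTheorem4 : (G : FinGroup) (K : PermClass (Ω G)) (X Y : PermClass.Object K) →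
    IsHaar G K X → IsHaar G K Y →
    (Σ (Perm (Ω G)) λ φ → InNormalizer G φ × PermClass._≈_ K (PermClass.act K φ X) Y)
    ⇔
    (Σ (Fin 2) λ i → Σ (Aut G) λ α → Σ (FinGroup.Carrier G) λ g →
    InNormalizer G (τ^ G i ∘ₚ (hatAut G α ∘ₚ bar G g))
    × PermClass._≈_ K (PermClass.act K (τ^ G i ∘ₚ (hatAut G α ∘ₚ bar G g)) X) Y)
mainTheorem4 G K X Y _ Y-haar = mk⇔
  (λ (φ , φ-normalizes , φX≈Y) →
    let (i , α , g , χX≈Y) = normalizer-iso⇒standard-iso G K Y-haar φ-normalizes φX≈Y
    in  i , α , g , standard-inNormalizer G i α g , χX≈Y)
  (λ (_ , _ , _ , χ-normalizes , χX≈Y) → _ , χ-normalizes , χX≈Y)
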